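{- For all positive integers $k_1\le k_2$ and $r$, $3\leq\chi_{la}(S_{k_{1},k_{2}}\diamond \overline{K_{r}})\leq 4$.
   Context: All graphs are finite and simple. For a graph $G$ with $m$ edges, a bijection $f:E(G)\to\{1,2,\dots,m\}$ is a local antimagic labeling if $\omega(u)\neq\omega(v)$ for every edge $uv$, where $\omega(u)=\sum_{e\in E(u)}f(e)$ and $E(u)$ is the set of edges incident with $u$. The local antimagic chromatic number $\chi_{la}(G)$ is the minimum number of distinct values of $\omega$ over all local antimagic labelings of $G$. The double star $S_{k_1,k_2}$ is obtained from stars $S_{k_1}$ and $S_{k_2}$ (with $k_1$ and $k_2$ leaves and centers $c_1,c_2$) by adding the edge $c_1c_2$. $\overline{K_r}$ is the edgeless graph on $r$ vertices. For graphs $G,H$, the edge-corona product $G\diamond H$ is obtained from one copy of $G$ and $|E(G)|$ disjoint copies of $H$, one assigned to each edge of $G$, by joining, for each edge $uv\in E(G)$, both $u$ and $v$ to every vertex of the copy of $H$ assigned to $uv$. -}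

module Defs where

open import Data.Nat as ℕ using (ℕ; zero; suc; _+_; _*_; _≤_)
open import Data.Fin as Fin using (Fin; toℕ; _↑ˡ_; _↑ʳ_; splitAt; remQuot; combine)
open import Data.Fin.Properties using () renaming (_≟_ to _≟ᶠ_)
open import Data.Nat.Properties using () renaming (_≟_ to _≟ⁿ_)
open import Data.List using (List; length; map; allFin; deduplicate)
open import Data.Nat.ListAction using (sum)
open import Data.Product using (_×_; _,_; proj₁; proj₂; Σ)
open import Data.Sum using (inj₁; inj₂)
open import Data.Bool using (Bool; if_then_else_; _∨_)
open import Relation.Nullary using (¬_)
open import Relation.Nullary.Decidable using (⌊_⌋)
open import Relation.Binary.PropositionalEquality using (_≡_)
open import Function.Bundles using (_⤖_; Bijection)

record Graph : Set where
  constructor graph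
  field
    nV   : ℕ
    nE   : ℕ
    ends : Fin nE → Fin nV × Fin nV
open Graph public

emptyGraph : ℕ → Graph
emptyGraph r = graph r 0 (λ ())

-- Double star S_{k1,k2}: vertices 0 = c1, 1 = c2, then the k1 leaves of c1,
-- then the k2 leaves of c2.  Edge 0 = c1c2, then c1-leaf edges, then c2-leaf edges.
doubleStar : ℕ → ℕ → Graph
doubleStar k₁ k₂ = graph (2 + (k₁ + k₂)) (suc (k₁ + k₂)) e
  where
  c₁ c₂ : Fin (2 + (k₁ + k₂))
  c₁ = Fin.zero
  c₂ = Fin.suc Fin.zero
  e : Fin (suc (k₁ + k₂)) → Fin (2 + (k₁ + k₂)) × Fin (2 + (k₁ + k₂))
  e Fin.zero = c₁ , c₂
  e (Fin.suc i) with splitAt k₁ i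
  ... | inj₁ a = c₁ , 2 ↑ʳ (a ↑ˡ k₂)
  ... | inj₂ b = c₂ , 2 ↑ʳ (k₁ ↑ʳ b)

-- Vertices: those of G, then for each edge e of G
-- a copy of H (vertex (e , x) encoded by combine e x).
-- Edges: those of G; then the edges of each copy of H; then for each
-- edge e = uv of G and vertex x of H, the edge u-(e,x); then the edge v-(e,x).
_⋄_ : Graph → Graph → Graph
G ⋄ H = graph (n + m * h) (m + (m * eH + (m * h + m * h))) E
  where
  n = nV G
  m = nE G
  h = nV H
  eH = nE H
  old : Fin n → Fin (n + m * h)
  old u = u ↑ˡ (m * h)
  cp : Fin m → Fin h → Fin (n + m * h)
  cp e x = n ↑ʳ combine e x
  E : Fin (m + (m * eH + (m * h + m * h))) → Fin (n + m * h) × Fin (n + m * h)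
  E i with splitAt m i
  ... | inj₁ e = old (proj₁ (ends G e)) , old (proj₂ (ends G e))
  ... | inj₂ j with splitAt (m * eH) j
  ... | inj₁ p with remQuot {m} eH p
  ... | (e , f) = cp e (proj₁ (ends H f)) , cp e (proj₂ (ends H f))
  E i | inj₂ j | inj₂ k with splitAt (m * h) k
  ... | inj₁ p with remQuot {m} h p
  ... | (e , x) = old (proj₁ (ends G e)) , cp e x
  E i | inj₂ j | inj₂ k | inj₂ p with remQuot {m} h p
  ... | (e , x) = old (proj₂ (ends G e)) , cp e x

-- An edge labeling: a bijection from E(G) onto {1,…,m}; edge e gets label 1 + toℕ (to f e).
Labeling : Graph → Set
Labeling G = Fin (nE G) ⤖ Fin (nE G)

label : (G : Graph) → Labeling G → Fin (nE G) → ℕ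
label G f e = suc (toℕ (Bijection.to f e))

incident : (G : Graph) → Fin (nE G) → Fin (nV G) → Bool
incident G e u = ⌊ proj₁ (ends G e) ≟ᶠ u ⌋ ∨ ⌊ proj₂ (ends G e) ≟ᶠ u ⌋

weight : (G : Graph) → Labeling G → Fin (nV G) → ℕ
weight G f u = sum (map (λ e → if incident G e u then label G f e else 0) (allFin (nE G)))

IsLocalAntimagic : (G : Graph) → Labeling G → Set
IsLocalAntimagic G f = ∀ e → ¬ (weight G f (proj₁ (ends G e)) ≡ weight G f (proj₂ (ends G e)))

numColors : (G : Graph) → Labeling G → ℕ
numColors G f = length (deduplicate _≟ⁿ_ (map (weight G f) (allFin (nV G))))

χla≤ : Graph → ℕ → Set
χla≤ G c = Σ (Labeling G) λ f → IsLocalAntimagic G f × numColors G f ≤ c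

χla≥ : Graph → ℕ → Set
χla≥ G c = ∀ (f : Labeling G) → IsLocalAntimagic G f → c ≤ numColors G f

module Submission where

-- Three colours are forced: the centres c₁, c₂ and any vertex of the copy of K̄_r on the central
-- edge c₁c₂ form a triangle.
--
-- Four colours suffice.  Let m = k₁ + k₂ + 1 be the number of edges of the double star and N = m r.
-- Edge e of the double star gets the label 2N + 1 + e, and the labels 1, …, 2N are split into the
-- N pairs {p + 1, 2N − p}, one pair for the two edges at each copy vertex, which therefore all weigh
-- 2N + 1.  The copies (e , x) are laid out in r rows of m: row x uses the pairs
-- p = m (r − 1 − x) + τₓ(e) for a permutation τₓ, and the leaf side normally takes the small label
-- p + 1.  Alternating reversed and identity rows, plus for even r one row folded between small and
-- large labels, make the leaf side of edge e lose exactly what the label of e gains as e grows, so all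
-- leaves weigh the same Q > 2N + 1.  On the central edge the large labels go to the c₂ side; as the
-- leaf edges of c₂ also carry larger labels and k₁ ≤ k₂, c₂ is heavier than c₁.  Finally, in a leaf
-- column at most one copy puts its large label on the leaf side, so the leaf side exceeds the centre
-- side by less than 2N + 1, the label of the central edge: both centres outweigh the leaves, and
-- 2N + 1 < Q < w(c₁) < w(c₂) are the only weights.

open import Defs
open import Data.Bool using (Bool; true; false; if_then_else_; _∨_)
open import Data.Bool.Properties using (∨-identityʳ)
open import Data.Empty using (⊥; ⊥-elim)
open import Data.Fin as Fin using (Fin; toℕ; _↑ˡ_; _↑ʳ_; splitAt; combine; remQuot; opposite; cast)
open import Data.Fin.Patterns using (0F; 1F)
open import Data.Fin.Permutation
  using (Permutation′; _⟨$⟩ʳ_; _⟨$⟩ˡ_; inverseˡ; inverseʳ; reverse; cast-id)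
import Data.Fin.Properties as Finₚ
open Finₚ using (+↔⊎; *↔×)
open import Data.List using (List; []; _∷_; map; allFin; length; tabulate)
import Data.List.Properties as Listₚ
open import Data.List.Membership.Propositional using (_∈_)
open import Data.List.Membership.Propositional.Properties
  using (∈-map⁺; ∈-map⁻; ∈-allFin; ∈-deduplicate⁺; ∈-deduplicate⁻)
open import Data.List.Relation.Binary.Subset.Propositional using (_⊆_)
open import Data.List.Relation.Unary.All using ([]; _∷_; lookup)
open import Data.List.Relation.Unary.Any using (here; there)
open import Data.List.Relation.Unary.Unique.Propositional using (Unique; []; _∷_)
open import Data.Nat using (ℕ; zero; suc; _+_; _*_; _∸_; _≤_; _<_; z≤n; s≤s; z<s; ⌊_/2⌋; ⌈_/2⌉)
open import Data.Nat.ListAction using () renaming (sum to listSum)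
open import Data.Nat.Properties
open import Algebra.Properties.CommutativeMonoid.Sum +-0-commutativeMonoid
  using (sum; sum-syntax; ∑-distrib-+; sum-cong-≗)
open import Data.List.Relation.Unary.Unique.DecPropositional.Properties _≟_ using (deduplicate-!)
open import Data.Nat.Tactic.RingSolver using (solve-∀)
open import Data.Product using (_×_; _,_; proj₁; proj₂; ∃-syntax)
open import Data.Product.Function.NonDependent.Propositional using (_×-↔_)
open import Data.Sum as Sum using (_⊎_; inj₁; inj₂; [_,_]; [_,_]′)
open import Data.Sum.Function.Propositional using (_⊎-↔_)
open import Function using (_∘_; id)
open import Function.Bundles using (_↔_; Inverse; mk↔ₛ′)
open import Function.Definitions using (Injective)
open import Function.Properties.Inverse using (↔-refl; ↔-sym; ↔-trans; ↔⇒⤖)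
open import Function.Related.TypeIsomorphisms using (×-comm; ⊎-comm)
open import Relation.Binary.PropositionalEquality hiding ([_])
open import Relation.Nullary using (yes; no)
open import Relation.Nullary.Decidable using (⌊_⌋)
open import Relation.Nullary.Negation using (contradiction)

-- Finite sums

listSum-allFin : ∀ n (f : Fin n → ℕ) → listSum (map f (allFin n)) ≡ ∑[ i < n ] f i
listSum-allFin n f = trans (cong listSum (Listₚ.map-tabulate id f)) (go n f)
  where
  go : ∀ n (f : Fin n → ℕ) → listSum (tabulate f) ≡ sum f
  go zero    f = refl
  go (suc n) f = cong (f 0F +_) (go n (f ∘ Fin.suc))

∑-+ : ∀ a b (f : Fin (a + b) → ℕ) → sum f ≡ ∑[ i < a ] f (i ↑ˡ b) + ∑[ j < b ] f (a ↑ʳ j)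
∑-+ zero    b f = refl
∑-+ (suc a) b f = trans (cong (f 0F +_) (∑-+ a b (f ∘ Fin.suc))) (sym (+-assoc (f 0F) _ _))

∑-combine : ∀ a b (f : Fin (a * b) → ℕ) → sum f ≡ ∑[ i < a ] ∑[ j < b ] f (combine i j)
∑-combine zero    b f = refl
∑-combine (suc a) b f =
  trans (∑-+ b (a * b) f) (cong (∑[ j < b ] f (j ↑ˡ (a * b)) +_) (∑-combine a b (f ∘ (b ↑ʳ_))))

∑-zero : ∀ {n} {f : Fin n → ℕ} → (∀ i → f i ≡ 0) → sum f ≡ 0
∑-zero {zero}  f≡0 = refl
∑-zero {suc n} f≡0 = cong₂ _+_ (f≡0 0F) (∑-zero (f≡0 ∘ Fin.suc))

∑-const : ∀ n c → ∑[ i < n ] c ≡ n * c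
∑-const zero    c = refl
∑-const (suc n) c = cong (c +_) (∑-const n c)

∑-single : ∀ {n} (k : Fin n) {f : Fin n → ℕ} → (∀ i → i ≢ k → f i ≡ 0) → sum f ≡ f k
∑-single 0F          {f} f≡0 = trans (cong (f 0F +_) (∑-zero λ i → f≡0 (Fin.suc i) λ ())) (+-identityʳ _)
∑-single (Fin.suc k) {f} f≡0 = trans (cong (_+ sum (f ∘ Fin.suc)) (f≡0 0F λ ()))
  (∑-single k λ i i≢k → f≡0 (Fin.suc i) (i≢k ∘ Finₚ.suc-injective))

∑-if : ∀ {n} b (g : Fin n → ℕ) → ∑[ i < n ] (if b then g i else 0) ≡ (if b then sum g else 0)
∑-if     true  g = refl
∑-if {n} false g = ∑-zero {n} {λ _ → 0} λ _ → refl

∑-mono-≤ : ∀ {n} {f g : Fin n → ℕ} → (∀ i → f i ≤ g i) → sum f ≤ sum g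
∑-mono-≤ {zero}  f≤g = z≤n
∑-mono-≤ {suc n} f≤g = +-mono-≤ (f≤g 0F) (∑-mono-≤ (f≤g ∘ Fin.suc))

∑-mono-< : ∀ {n} {f g : Fin (suc n) → ℕ} → (∀ i → f i < g i) → sum f < sum g
∑-mono-< f<g = +-mono-<-≤ (f<g 0F) (∑-mono-≤ (<⇒≤ ∘ f<g ∘ Fin.suc))

term≤∑ : ∀ {n} (f : Fin n → ℕ) i → f i ≤ sum f
term≤∑ f 0F          = m≤m+n _ _
term≤∑ f (Fin.suc i) = ≤-trans (term≤∑ (f ∘ Fin.suc) i) (m≤n+m _ _)

∑-inject≤ : ∀ {a b} (a≤b : a ≤ b) (g : Fin b → ℕ) → ∑[ i < a ] g (Fin.inject≤ i a≤b) ≤ sum g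
∑-inject≤ {zero}          a≤b       g = z≤n
∑-inject≤ {suc a} {suc b} (s≤s a≤b) g = +-monoʳ-≤ (g 0F) (∑-inject≤ a≤b (g ∘ Fin.suc))

⌊≟⌋-refl : ∀ {k} (a : Fin k) → ⌊ a Finₚ.≟ a ⌋ ≡ true
⌊≟⌋-refl a = cong ⌊_⌋ (≡-≟-identity Finₚ._≟_ refl)

⌊≟⌋-≢ : ∀ {k} {a b : Fin k} → a ≢ b → ⌊ a Finₚ.≟ b ⌋ ≡ false
⌊≟⌋-≢ a≢b = cong ⌊_⌋ (≢-≟-identity Finₚ._≟_ a≢b)

⌊≟⌋-injective : ∀ {k l} {g : Fin k → Fin l} → Injective _≡_ _≡_ g →
                ∀ a b → ⌊ g a Finₚ.≟ g b ⌋ ≡ ⌊ a Finₚ.≟ b ⌋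
⌊≟⌋-injective g-inj a b with a Finₚ.≟ b
... | yes refl = ⌊≟⌋-refl _
... | no a≢b   = ⌊≟⌋-≢ (a≢b ∘ g-inj)

↑ˡ<↑ʳ : ∀ {k l} (a : Fin k) (b : Fin l) → toℕ (a ↑ˡ l) < toℕ (k ↑ʳ b)
↑ˡ<↑ʳ {k} {l} a b = subst₂ _<_ (sym (Finₚ.toℕ-↑ˡ a l)) (sym (Finₚ.toℕ-↑ʳ k b))
  (≤-trans (Finₚ.toℕ<n a) (m≤m+n k (toℕ b)))

↑ˡ≢↑ʳ : ∀ {k l} (a : Fin k) (b : Fin l) → a ↑ˡ l ≢ k ↑ʳ b
↑ˡ≢↑ʳ a b eq = <⇒≢ (↑ˡ<↑ʳ a b) (cong toℕ eq)

-- Counting colours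

∈-remove : ∀ {x : ℕ} {ys} → x ∈ ys →
           ∃[ zs ] length ys ≡ suc (length zs) × (∀ {y} → y ∈ ys → y ≢ x → y ∈ zs)
∈-remove {ys = y ∷ ys} (here refl) = ys , refl , λ where
  (here y≡x) y≢x → ⊥-elim (y≢x y≡x)
  (there p)  _   → p
∈-remove {ys = y ∷ ys} (there x∈ys) with zs , len , keep ← ∈-remove x∈ys =
  y ∷ zs , cong suc len , λ where
    (here refl) _   → here refl
    (there p)   y≢x → there (keep p y≢x)

unique-⊆⇒length≤ : ∀ {xs ys : List ℕ} → Unique xs → xs ⊆ ys → length xs ≤ length ys
unique-⊆⇒length≤ []              _     = z≤n
unique-⊆⇒length≤ (x∉xs ∷ unique) xs⊆ys with zs , len , keep ← ∈-remove (xs⊆ys (here refl)) =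
  subst (_ ≤_) (sym len) (s≤s (unique-⊆⇒length≤ unique λ y∈xs →
    keep (xs⊆ys (there y∈xs)) λ { refl → lookup x∉xs y∈xs refl }))

weights : (G : Graph) → Labeling G → List ℕ
weights G f = map (weight G f) (allFin (nV G))

weight∈weights : ∀ G f u → weight G f u ∈ weights G f
weight∈weights G f u = ∈-map⁺ (weight G f) (∈-allFin u)

length≤numColors : ∀ G f {ys} → Unique ys → ys ⊆ weights G f → length ys ≤ numColors G f
length≤numColors G f unique ys⊆ = unique-⊆⇒length≤ unique (∈-deduplicate⁺ _≟_ ∘ ys⊆)

numColors≤length : ∀ G f ys → (∀ u → weight G f u ∈ ys) → numColors G f ≤ length ys
numColors≤length G f ys w∈ys = unique-⊆⇒length≤ (deduplicate-! (weights G f)) λ y∈ →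
  let u , _ , y≡wu = ∈-map⁻ (weight G f) (∈-deduplicate⁻ _≟_ (weights G f) y∈)
  in subst (_∈ ys) (sym y≡wu) (w∈ys u)

weights-differ : ∀ G f → IsLocalAntimagic G f →
                 ∀ i {u v} → ends G i ≡ (u , v) → weight G f u ≢ weight G f v
weights-differ G f antimagic i ends≡ = subst (λ (u , v) → weight G f u ≢ weight G f v) ends≡ (antimagic i)

triangle⇒χla≥3 : ∀ G {u v w} i j k →
                 ends G i ≡ (u , v) → ends G j ≡ (u , w) → ends G k ≡ (v , w) → χla≥ G 3
triangle⇒χla≥3 G i j k uv uw vw f antimagic = length≤numColors G f
  ((differ i uv ∷ differ j uw ∷ []) ∷ (differ k vw ∷ []) ∷ [] ∷ [])
  λ { (here refl)                 → weight∈weights G f _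
    ; (there (here refl))         → weight∈weights G f _
    ; (there (there (here refl))) → weight∈weights G f _ }
  where differ = weights-differ G f antimagic

-- Edge coronas G ⋄ K̄_r

swapUnless : ∀ {A : Set} → (A → Bool) → A ⊎ A → A ⊎ A
swapUnless keep (inj₁ a) = if keep a then inj₁ a else inj₂ a
swapUnless keep (inj₂ a) = if keep a then inj₂ a else inj₁ a

swapUnless-involutive : ∀ {A : Set} (keep : A → Bool) s → swapUnless keep (swapUnless keep s) ≡ s
swapUnless-involutive keep (inj₁ a) with keep a in eq
... | true  rewrite eq = refl
... | false rewrite eq = refl
swapUnless-involutive keep (inj₂ a) with keep a in eq
... | true  rewrite eq = refl
... | false rewrite eq = refl

swapUnless-↔ : ∀ {A : Set} → (A → Bool) → (A ⊎ A) ↔ (A ⊎ A)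
swapUnless-↔ keep = mk↔ₛ′ (swapUnless keep) (swapUnless keep)
  (swapUnless-involutive keep) (swapUnless-involutive keep)

module Corona (G : Graph) (r : ℕ) where

  m n N : ℕ
  m = nE G
  n = nV G
  N = m * r

  GK : Graph
  GK = G ⋄ emptyGraph r

  old : Fin n → Fin (nV GK)
  old v = v ↑ˡ N

  copy : Fin N → Fin (nV GK)
  copy q = n ↑ʳ q

  first second : Fin m → Fin n
  first e = proj₁ (ends G e)
  second e = proj₂ (ends G e)

  edgeOf : Fin N → Fin m
  edgeOf q = proj₁ (remQuot {m} r q)

  edgeOf-combine : ∀ e x → edgeOf (combine e x) ≡ e
  edgeOf-combine e x = cong proj₁ (Finₚ.remQuot-combine e x)

  noEdgesInCopies : Fin (m * 0) → ⊥
  noEdgesInCopies i = Finₚ.¬Fin0 (cast (*-zeroʳ m) i)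

  edgeBlocks : Fin (nE GK) ↔ (Fin m ⊎ (Fin N ⊎ Fin N))
  edgeBlocks = ↔-trans +↔⊎ (↔-refl ⊎-↔ ↔-trans +↔⊎ (↔-trans (↔-refl ⊎-↔ +↔⊎) dropEmpty))
    where
    dropEmpty : ∀ {A : Set} → (Fin (m * 0) ⊎ A) ↔ A
    dropEmpty = mk↔ₛ′ [ ⊥-elim ∘ noEdgesInCopies , id ]′ inj₂ (λ _ → refl)
      [ ⊥-elim ∘ noEdgesInCopies , (λ _ → refl) ]

  gEdge : Fin m → Fin (nE GK)
  gEdge e = Inverse.from edgeBlocks (inj₁ e)

  firstEdge secondEdge : Fin N → Fin (nE GK)
  firstEdge q = Inverse.from edgeBlocks (inj₂ (inj₁ q))
  secondEdge q = Inverse.from edgeBlocks (inj₂ (inj₂ q))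

  edgeCases : (P : Fin (nE GK) → Set) →
              (∀ e → P (gEdge e)) → (∀ q → P (firstEdge q)) → (∀ q → P (secondEdge q)) → ∀ i → P i
  edgeCases P onG on₁ on₂ i = subst P (Inverse.strictlyInverseʳ edgeBlocks i) (byBlock (Inverse.to edgeBlocks i))
    where
    byBlock : ∀ b → P (Inverse.from edgeBlocks b)
    byBlock (inj₁ e)        = onG e
    byBlock (inj₂ (inj₁ q)) = on₁ q
    byBlock (inj₂ (inj₂ q)) = on₂ q

  vertexCases : (P : Fin (nV GK) → Set) → (∀ v → P (old v)) → (∀ q → P (copy q)) → ∀ u → P u
  vertexCases P onOld onCopy u = subst P (Finₚ.join-splitAt n N u) (byBlock (splitAt n u))
    where
    byBlock : ∀ b → P (Fin.join n N b)
    byBlock (inj₁ v) = onOld v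
    byBlock (inj₂ q) = onCopy q

  ends-gEdge : ∀ e → ends GK (gEdge e) ≡ (old (first e) , old (second e))
  ends-gEdge e rewrite Finₚ.splitAt-↑ˡ m e (m * 0 + (N + N)) = refl

  ends-firstEdge : ∀ q → ends GK (firstEdge q) ≡ (old (first (edgeOf q)) , copy q)
  ends-firstEdge q rewrite Finₚ.splitAt-↑ʳ m (m * 0 + (N + N)) (m * 0 ↑ʳ (q ↑ˡ N))
                         | Finₚ.splitAt-↑ʳ (m * 0) (N + N) (q ↑ˡ N)
                         | Finₚ.splitAt-↑ˡ N q N
    = cong (λ q′ → old (first (edgeOf q)) , n ↑ʳ q′) (Finₚ.combine-remQuot {m} r q)

  ends-secondEdge : ∀ q → ends GK (secondEdge q) ≡ (old (second (edgeOf q)) , copy q)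
  ends-secondEdge q rewrite Finₚ.splitAt-↑ʳ m (m * 0 + (N + N)) (m * 0 ↑ʳ (N ↑ʳ q))
                          | Finₚ.splitAt-↑ʳ (m * 0) (N + N) (N ↑ʳ q)
                          | Finₚ.splitAt-↑ʳ N N q
    = cong (λ q′ → old (second (edgeOf q)) , n ↑ʳ q′) (Finₚ.combine-remQuot {m} r q)

  χla≥3 : Fin m → Fin r → χla≥ GK 3
  χla≥3 e x = triangle⇒χla≥3 GK (gEdge e) (firstEdge q) (secondEdge q) (ends-gEdge e)
    (trans (ends-firstEdge q) (cong (λ e′ → old (first e′) , copy q) (edgeOf-combine e x)))
    (trans (ends-secondEdge q) (cong (λ e′ → old (second e′) , copy q) (edgeOf-combine e x)))
    where q = combine e x

  ⌊old≟old⌋ : ∀ a b → ⌊ old a Finₚ.≟ old b ⌋ ≡ ⌊ a Finₚ.≟ b ⌋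
  ⌊old≟old⌋ = ⌊≟⌋-injective (Finₚ.↑ˡ-injective N _ _)

  ⌊copy≟copy⌋ : ∀ p q → ⌊ copy p Finₚ.≟ copy q ⌋ ≡ ⌊ p Finₚ.≟ q ⌋
  ⌊copy≟copy⌋ = ⌊≟⌋-injective (Finₚ.↑ʳ-injective n _ _)

  ⌊old≟copy⌋ : ∀ v q → ⌊ old v Finₚ.≟ copy q ⌋ ≡ false
  ⌊old≟copy⌋ v q = ⌊≟⌋-≢ (↑ˡ≢↑ʳ v q)

  ⌊copy≟old⌋ : ∀ q v → ⌊ copy q Finₚ.≟ old v ⌋ ≡ false
  ⌊copy≟old⌋ q v = ⌊≟⌋-≢ (↑ˡ≢↑ʳ v q ∘ sym)

  module Weights (f : Labeling GK) where

    w : Fin (nV GK) → ℕ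
    w = weight GK f

    L : Fin (nE GK) → ℕ
    L = label GK f

    Σfirst Σsecond : Fin m → ℕ
    Σfirst e = ∑[ x < r ] L (firstEdge (combine e x))
    Σsecond e = ∑[ x < r ] L (secondEdge (combine e x))

    shareWith : Bool → Bool → Fin m → ℕ
    shareWith isFirst isSecond e = (if isFirst ∨ isSecond then L (gEdge e) else 0)
                                 + ((if isFirst then Σfirst e else 0) + (if isSecond then Σsecond e else 0))

    share : Fin n → Fin m → ℕ
    share v e = shareWith ⌊ first e Finₚ.≟ v ⌋ ⌊ second e Finₚ.≟ v ⌋ e

    share-at : ∀ v e {a b} → ends G e ≡ (a , b) →
               share v e ≡ shareWith ⌊ a Finₚ.≟ v ⌋ ⌊ b Finₚ.≟ v ⌋ e
    share-at v e ends≡ rewrite ends≡ = refl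

    private
      contribution : Fin (nV GK) → Fin (nE GK) → ℕ
      contribution u i = if incident GK i u then L i else 0

      contribution-at : ∀ u i {a b c} → ends GK i ≡ (a , b) →
                        ⌊ a Finₚ.≟ u ⌋ ∨ ⌊ b Finₚ.≟ u ⌋ ≡ c → contribution u i ≡ (if c then L i else 0)
      contribution-at u i ends≡ c≡ rewrite ends≡ | c≡ = refl

      weight-blocks : ∀ u → w u ≡ ∑[ e < m ] contribution u (gEdge e)
                                  + (∑[ q < N ] contribution u (firstEdge q) + ∑[ q < N ] contribution u (secondEdge q))
      weight-blocks u = begin
        w u                                                   ≡⟨ listSum-allFin (nE GK) (contribution u) ⟩
        sum (contribution u)                                  ≡⟨ ∑-+ m _ (contribution u) ⟩
        onG + sum inCopies                                    ≡⟨ cong (onG +_) (∑-+ (m * 0) (N + N) inCopies) ⟩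
        onG + (∑[ i < m * 0 ] inCopies (i ↑ˡ (N + N)) + sum onCopies)
          ≡⟨ cong (λ z → onG + (z + sum onCopies)) (∑-zero (⊥-elim ∘ noEdgesInCopies)) ⟩
        onG + sum onCopies                                    ≡⟨ cong (onG +_) (∑-+ N N onCopies) ⟩
        onG + (∑[ q < N ] contribution u (firstEdge q) + ∑[ q < N ] contribution u (secondEdge q)) ∎
        where
        open ≡-Reasoning
        onG = ∑[ e < m ] contribution u (gEdge e)
        inCopies = λ j → contribution u (m ↑ʳ j)
        onCopies = λ j → inCopies (m * 0 ↑ʳ j)

    weight-copy : ∀ q → w (copy q) ≡ L (firstEdge q) + L (secondEdge q)
    weight-copy q = begin
      w (copy q)                                                        ≡⟨ weight-blocks (copy q) ⟩
      ∑[ e < m ] contribution (copy q) (gEdge e)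
        + (∑[ p < N ] contribution (copy q) (firstEdge p) + ∑[ p < N ] contribution (copy q) (secondEdge p))
        ≡⟨ cong₂ _+_ (∑-zero notOnG) (cong₂ _+_ (∑-single q (offCopy ends-firstEdge))
                                                (∑-single q (offCopy ends-secondEdge))) ⟩
      0 + (contribution (copy q) (firstEdge q) + contribution (copy q) (secondEdge q))
        ≡⟨ cong₂ _+_ (onCopy ends-firstEdge) (onCopy ends-secondEdge) ⟩
      L (firstEdge q) + L (secondEdge q)                                ∎
      where
      open ≡-Reasoning
      notOnG : ∀ e → contribution (copy q) (gEdge e) ≡ 0
      notOnG e = contribution-at (copy q) (gEdge e) (ends-gEdge e)
        (cong₂ _∨_ (⌊old≟copy⌋ (first e) q) (⌊old≟copy⌋ (second e) q))
      offCopy : ∀ {side : Fin N → Fin (nE GK)} {end : Fin N → Fin n} →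
                (∀ p → ends GK (side p) ≡ (old (end p) , copy p)) →
                ∀ p → p ≢ q → contribution (copy q) (side p) ≡ 0
      offCopy {end = end} ends≡ p p≢q = contribution-at (copy q) _ (ends≡ p)
        (cong₂ _∨_ (⌊old≟copy⌋ (end p) q) (trans (⌊copy≟copy⌋ p q) (⌊≟⌋-≢ p≢q)))
      onCopy : ∀ {side : Fin N → Fin (nE GK)} {end : Fin N → Fin n} →
               (∀ p → ends GK (side p) ≡ (old (end p) , copy p)) → contribution (copy q) (side q) ≡ L (side q)
      onCopy {end = end} ends≡ = contribution-at (copy q) _ (ends≡ q)
        (cong₂ _∨_ (⌊old≟copy⌋ (end q) q) (⌊≟⌋-refl (copy q)))

    weight-old : ∀ v → w (old v) ≡ ∑[ e < m ] share v e
    weight-old v = begin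
      w (old v)                                                         ≡⟨ weight-blocks (old v) ⟩
      ∑[ e < m ] contribution (old v) (gEdge e)
        + (∑[ q < N ] contribution (old v) (firstEdge q) + ∑[ q < N ] contribution (old v) (secondEdge q))
        ≡⟨ cong₂ _+_ (sum-cong-≗ onG)
                     (cong₂ _+_ (viaCopies first ends-firstEdge) (viaCopies second ends-secondEdge)) ⟩
      sum byG + (sum byFirst + sum bySecond)          ≡⟨ cong (sum byG +_) (∑-distrib-+ byFirst bySecond) ⟨
      sum byG + ∑[ e < m ] (byFirst e + bySecond e)   ≡⟨ ∑-distrib-+ byG (λ e → byFirst e + bySecond e) ⟨
      ∑[ e < m ] share v e                            ∎
      where
      open ≡-Reasoning
      byG = λ e → if ⌊ first e Finₚ.≟ v ⌋ ∨ ⌊ second e Finₚ.≟ v ⌋ then L (gEdge e) else 0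
      byFirst = λ e → if ⌊ first e Finₚ.≟ v ⌋ then Σfirst e else 0
      bySecond = λ e → if ⌊ second e Finₚ.≟ v ⌋ then Σsecond e else 0
      onG : ∀ e → contribution (old v) (gEdge e) ≡ byG e
      onG e = contribution-at (old v) (gEdge e) (ends-gEdge e)
        (cong₂ _∨_ (⌊old≟old⌋ (first e) v) (⌊old≟old⌋ (second e) v))
      viaCopies : ∀ {side : Fin N → Fin (nE GK)} (end : Fin m → Fin n) →
                  (∀ q → ends GK (side q) ≡ (old (end (edgeOf q)) , copy q)) →
                  ∑[ q < N ] contribution (old v) (side q)
                    ≡ ∑[ e < m ] (if ⌊ end e Finₚ.≟ v ⌋ then ∑[ x < r ] L (side (combine e x)) else 0)
      viaCopies {side} end ends≡ = trans (∑-combine m r _) (sum-cong-≗ λ e →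
        trans (sum-cong-≗ λ x → contribution-at (old v) _ (ends≡ (combine e x))
                (trans (cong₂ _∨_ (endAt e x) (⌊copy≟old⌋ (combine e x) v)) (∨-identityʳ _)))
              (∑-if _ (λ x → L (side (combine e x)))))
        where
        endAt : ∀ e x → ⌊ old (end (edgeOf (combine e x))) Finₚ.≟ old v ⌋ ≡ ⌊ end e Finₚ.≟ v ⌋
        endAt e x = trans (cong (λ e′ → ⌊ old (end e′) Finₚ.≟ old v ⌋) (edgeOf-combine e x))
                          (⌊old≟old⌋ (end e) v)

    antimagic-criterion : ∀ P → (∀ q → w (copy q) ≡ P) → (∀ v → P < w (old v)) →
                          (∀ e → w (old (first e)) ≢ w (old (second e))) → IsLocalAntimagic GK f
    antimagic-criterion P copy≡P P<old differOnG = edgeCases Differ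
      (λ e → differ-at (gEdge e) (ends-gEdge e) (differOnG e))
      (λ q → differ-at (firstEdge q) (ends-firstEdge q) (oldCopy q))
      (λ q → differ-at (secondEdge q) (ends-secondEdge q) (oldCopy q))
      where
      Differ : Fin (nE GK) → Set
      Differ i = w (proj₁ (ends GK i)) ≢ w (proj₂ (ends GK i))
      differ-at : ∀ i {a b} → ends GK i ≡ (a , b) → w a ≢ w b → Differ i
      differ-at i ends≡ = subst (λ (a , b) → w a ≢ w b) (sym ends≡)
      oldCopy : ∀ q {v} → w (old v) ≢ w (copy q)
      oldCopy q {v} eq = <⇒≢ (P<old v) (sym (trans eq (copy≡P q)))

  rowsPermutation : (Fin r → Permutation′ m) → Permutation′ N
  rowsPermutation τ = ↔-trans *↔× (↔-trans (×-comm _ _) (↔-trans rowwise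
    (↔-trans (reverse ×-↔ ↔-refl) (↔-trans (↔-sym *↔×) (cast-id (*-comm r m))))))
    where
    rowwise : (Fin r × Fin m) ↔ (Fin r × Fin m)
    rowwise = mk↔ₛ′ (λ (x , e) → x , τ x ⟨$⟩ʳ e) (λ (x , c) → x , τ x ⟨$⟩ˡ c)
      (λ (x , c) → cong (x ,_) (inverseʳ (τ x))) (λ (x , e) → cong (x ,_) (inverseˡ (τ x)))

  toℕ-rowsPermutation : ∀ τ e x →
                        toℕ (rowsPermutation τ ⟨$⟩ʳ combine e x) ≡ m * toℕ (opposite x) + toℕ (τ x ⟨$⟩ʳ e)
  toℕ-rowsPermutation τ e x = begin
    toℕ (rowsPermutation τ ⟨$⟩ʳ combine e x)
      ≡⟨ cong (λ (e′ , x′) → toℕ (cast (*-comm r m) (combine (opposite x′) (τ x′ ⟨$⟩ʳ e′))))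
              (Finₚ.remQuot-combine e x) ⟩
    toℕ (cast (*-comm r m) (combine (opposite x) (τ x ⟨$⟩ʳ e)))  ≡⟨ Finₚ.toℕ-cast (*-comm r m) _ ⟩
    toℕ (combine (opposite x) (τ x ⟨$⟩ʳ e))                       ≡⟨ Finₚ.toℕ-combine (opposite x) _ ⟩
    m * toℕ (opposite x) + toℕ (τ x ⟨$⟩ʳ e)                       ∎
    where open ≡-Reasoning

  -- Copy (e , x) gets the pair of labels {p + 1, 2N − p} with p = position e x; the small label goes
  -- to its second edge, or to its first edge if flipped e x.  The edges of G get 2N + 1, …, 2N + m.
  module RowLabeling (τ : Fin r → Permutation′ m) (flipped : Fin m → Fin r → Bool) where

    π : Permutation′ N
    π = rowsPermutation τ

    position : Fin m → Fin r → ℕ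
    position e x = m * toℕ (opposite x) + toℕ (τ x ⟨$⟩ʳ e)

    flippedAt : Fin N → Bool
    flippedAt q = flipped (proj₁ (remQuot {m} r q)) (proj₂ (remQuot {m} r q))

    pairs : (Fin N ⊎ Fin N) ↔ (Fin N ⊎ Fin N)
    pairs = ↔-trans (swapUnless-↔ flippedAt) (π ⊎-↔ π)

    labelBlocks : ((Fin N ⊎ Fin N) ⊎ Fin m) ↔ Fin (nE GK)
    labelBlocks = ↔-trans (↔-trans (↔-refl ⊎-↔ reverse) (↔-sym +↔⊎) ⊎-↔ ↔-refl)
                          (↔-trans (↔-sym +↔⊎) (cast-id size))
      where
      size : N + N + m ≡ m + (m * 0 + (N + N))
      size = trans (+-comm (N + N) m) (cong (λ z → m + (z + (N + N))) (sym (*-zeroʳ m)))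

    labelIso : (Fin m ⊎ (Fin N ⊎ Fin N)) ↔ Fin (nE GK)
    labelIso = ↔-trans (⊎-comm _ _) (↔-trans (pairs ⊎-↔ ↔-refl) labelBlocks)

    labeling : Labeling GK
    labeling = ↔⇒⤖ (↔-trans edgeBlocks labelIso)

    L : Fin (nE GK) → ℕ
    L = label GK labeling

    halfValue : Fin N ⊎ Fin N → ℕ
    halfValue (inj₁ p) = suc (toℕ p)
    halfValue (inj₂ p) = suc (N + toℕ (opposite p))

    halfValue-pair : ∀ p → halfValue (inj₁ p) + halfValue (inj₂ p) ≡ suc (N + N)
    halfValue-pair p = begin
      suc (toℕ p) + suc (N + toℕ (opposite p))
        ≡⟨ cong (λ o → suc (toℕ p) + suc (N + o)) (Finₚ.opposite-prop p) ⟩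
      suc (toℕ p) + suc (N + (N ∸ suc (toℕ p)))    ≡⟨ shuffle (toℕ p) N (N ∸ suc (toℕ p)) ⟩
      suc (N + (suc (toℕ p) + (N ∸ suc (toℕ p))))
        ≡⟨ cong (λ k → suc (N + k)) (m+[n∸m]≡n (Finₚ.toℕ<n p)) ⟩
      suc (N + N)                                  ∎
      where
      open ≡-Reasoning
      shuffle : ∀ t a d → suc t + suc (a + d) ≡ suc (a + (suc t + d))
      shuffle = solve-∀

    label-from : ∀ s → L (Inverse.from edgeBlocks s) ≡ suc (toℕ (Inverse.to labelIso s))
    label-from s = cong (suc ∘ toℕ ∘ Inverse.to labelIso) (Inverse.strictlyInverseˡ edgeBlocks s)

    label-gEdge : ∀ e → L (gEdge e) ≡ suc (N + N + toℕ e)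
    label-gEdge e = trans (label-from (inj₁ e)) (cong suc (trans (Finₚ.toℕ-cast _ _) (Finₚ.toℕ-↑ʳ (N + N) e)))

    label-copy : ∀ s → L (Inverse.from edgeBlocks (inj₂ s)) ≡ halfValue (Inverse.to pairs s)
    label-copy s = trans (label-from (inj₂ s)) (value (Inverse.to pairs s))
      where
      value : ∀ h → suc (toℕ (Inverse.to labelBlocks (inj₁ h))) ≡ halfValue h
      value (inj₁ p) = cong suc (trans (Finₚ.toℕ-cast _ _)
        (trans (Finₚ.toℕ-↑ˡ (p ↑ˡ N) m) (Finₚ.toℕ-↑ˡ p N)))
      value (inj₂ p) = cong suc (trans (Finₚ.toℕ-cast _ _)
        (trans (Finₚ.toℕ-↑ˡ (N ↑ʳ opposite p) m) (Finₚ.toℕ-↑ʳ N (opposite p))))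

    label-pair : ∀ q → L (firstEdge q) + L (secondEdge q) ≡ suc (N + N)
    label-pair q = trans (cong₂ _+_ (label-copy (inj₁ q)) (label-copy (inj₂ q))) (byFlip (flippedAt q) refl)
      where
      byFlip : ∀ b → flippedAt q ≡ b →
               halfValue (Inverse.to pairs (inj₁ q)) + halfValue (Inverse.to pairs (inj₂ q)) ≡ suc (N + N)
      byFlip true  eq rewrite eq = halfValue-pair (π ⟨$⟩ʳ q)
      byFlip false eq rewrite eq = trans (+-comm (halfValue (inj₂ (π ⟨$⟩ʳ q))) _) (halfValue-pair (π ⟨$⟩ʳ q))

    flippedAt-combine : ∀ e x → flippedAt (combine e x) ≡ flipped e x
    flippedAt-combine e x = cong (λ (e′ , x′) → flipped e′ x′) (Finₚ.remQuot-combine e x)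

    toℕ-π : ∀ e x → toℕ (π ⟨$⟩ʳ combine e x) ≡ position e x
    toℕ-π = toℕ-rowsPermutation τ

    position<N : ∀ e x → position e x < N
    position<N e x = subst (_< N) (toℕ-π e x) (Finₚ.toℕ<n (π ⟨$⟩ʳ combine e x))

    label-first-flipped : ∀ e x → flipped e x ≡ true → L (firstEdge (combine e x)) ≡ suc (position e x)
    label-first-flipped e x isFlipped =
      trans (label-copy (inj₁ (combine e x))) (value (trans (flippedAt-combine e x) isFlipped))
      where
      value : flippedAt (combine e x) ≡ true →
              halfValue (Inverse.to pairs (inj₁ (combine e x))) ≡ suc (position e x)
      value eq rewrite eq = cong suc (toℕ-π e x)

    label-second-unflipped : ∀ e x → flipped e x ≡ false → L (secondEdge (combine e x)) ≡ suc (position e x)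
    label-second-unflipped e x notFlipped =
      trans (label-copy (inj₂ (combine e x))) (value (trans (flippedAt-combine e x) notFlipped))
      where
      value : flippedAt (combine e x) ≡ false →
              halfValue (Inverse.to pairs (inj₂ (combine e x))) ≡ suc (position e x)
      value eq rewrite eq = cong suc (toℕ-π e x)

    label-second≤N+N : ∀ q → L (secondEdge q) ≤ N + N
    label-second≤N+N q = ≤-pred (subst (suc (L (secondEdge q)) ≤_) (label-pair q)
      (+-monoˡ-≤ (L (secondEdge q)) (s≤s z≤n)))

    private
      other-half-large : ∀ {a b} → a + b ≡ suc (N + N) → a ≤ N → N < b
      other-half-large {a} {b} a+b≡ a≤N = +-cancelˡ-≤ N (suc N) b
        (subst (_≤ N + b) (trans a+b≡ (sym (+-suc N N))) (+-monoˡ-≤ b a≤N))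

    second≤first-unflipped : ∀ e x → flipped e x ≡ false →
                             L (secondEdge (combine e x)) ≤ L (firstEdge (combine e x))
    second≤first-unflipped e x notFlipped = ≤-trans second≤N (<⇒≤ (other-half-large
      (trans (+-comm (L (secondEdge (combine e x))) _) (label-pair (combine e x))) second≤N))
      where
      second≤N : L (secondEdge (combine e x)) ≤ N
      second≤N = subst (_≤ N) (sym (label-second-unflipped e x notFlipped)) (position<N e x)

    first<second-flipped : ∀ e x → flipped e x ≡ true →
                           L (firstEdge (combine e x)) < L (secondEdge (combine e x))
    first<second-flipped e x isFlipped = ≤-<-trans first≤N (other-half-large (label-pair (combine e x)) first≤N)
      where
      first≤N : L (firstEdge (combine e x)) ≤ N
      first≤N = subst (_≤ N) (sym (label-first-flipped e x isFlipped)) (position<N e x)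

-- Double stars

module DoubleStar (k₁ k₂ r : ℕ) where

  G : Graph
  G = doubleStar k₁ k₂

  open Corona G r public

  c₁ c₂ : Fin n
  c₁ = 0F
  c₂ = 1F

  leaf : Fin (k₁ + k₂) → Fin n
  leaf e′ = 2 ↑ʳ e′

  edge₁ : Fin k₁ → Fin m
  edge₁ a = Fin.suc (a ↑ˡ k₂)

  edge₂ : Fin k₂ → Fin m
  edge₂ b = Fin.suc (k₁ ↑ʳ b)

  ends-edge₁ : ∀ a → ends G (edge₁ a) ≡ (c₁ , leaf (a ↑ˡ k₂))
  ends-edge₁ a rewrite Finₚ.splitAt-↑ˡ k₁ a k₂ = refl

  ends-edge₂ : ∀ b → ends G (edge₂ b) ≡ (c₂ , leaf (k₁ ↑ʳ b))
  ends-edge₂ b rewrite Finₚ.splitAt-↑ʳ k₁ k₂ b = refl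

  ends-leafEdge : ∀ e′ → ends G (Fin.suc e′) ≡ (c₁ , leaf e′) ⊎ ends G (Fin.suc e′) ≡ (c₂ , leaf e′)
  ends-leafEdge e′ = subst LeafEdge (Finₚ.join-splitAt k₁ k₂ e′) (byBlock (splitAt k₁ e′))
    where
    LeafEdge : Fin (k₁ + k₂) → Set
    LeafEdge e″ = ends G (Fin.suc e″) ≡ (c₁ , leaf e″) ⊎ ends G (Fin.suc e″) ≡ (c₂ , leaf e″)
    byBlock : ∀ s → LeafEdge (Fin.join k₁ k₂ s)
    byBlock (inj₁ a) = inj₁ (ends-edge₁ a)
    byBlock (inj₂ b) = inj₂ (ends-edge₂ b)

  module DoubleStarWeights (f : Labeling GK) where

    open Weights f public

    LA : Fin m → ℕ
    LA e = L (gEdge e)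

    T : Fin m → ℕ
    T e = LA e + Σfirst e

    private
      share-edge₁ : ∀ a → share c₁ (edge₁ a) ≡ T (edge₁ a)
      share-edge₁ a = trans (share-at c₁ _ (ends-edge₁ a)) (cong (LA (edge₁ a) +_) (+-identityʳ _))

      share-edge₂ : ∀ b → share c₂ (edge₂ b) ≡ T (edge₂ b)
      share-edge₂ b = trans (share-at c₂ _ (ends-edge₂ b)) (cong (LA (edge₂ b) +_) (+-identityʳ _))

    weight-c₁ : w (old c₁) ≡ LA 0F + Σfirst 0F + ∑[ a < k₁ ] T (edge₁ a)
    weight-c₁ = begin
      w (old c₁)                                                  ≡⟨ weight-old c₁ ⟩
      share c₁ 0F + ∑[ e′ < k₁ + k₂ ] share c₁ (Fin.suc e′)
        ≡⟨ cong (share c₁ 0F +_) (∑-+ k₁ k₂ _) ⟩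
      LA 0F + (Σfirst 0F + 0) + (∑[ a < k₁ ] share c₁ (edge₁ a) + ∑[ b < k₂ ] share c₁ (edge₂ b))
        ≡⟨ cong₂ _+_ (cong (LA 0F +_) (+-identityʳ _))
                     (cong₂ _+_ (sum-cong-≗ share-edge₁) (∑-zero λ b → share-at c₁ _ (ends-edge₂ b))) ⟩
      LA 0F + Σfirst 0F + (∑[ a < k₁ ] T (edge₁ a) + 0)  ≡⟨ cong (LA 0F + Σfirst 0F +_) (+-identityʳ _) ⟩
      LA 0F + Σfirst 0F + ∑[ a < k₁ ] T (edge₁ a)        ∎
      where open ≡-Reasoning

    weight-c₂ : w (old c₂) ≡ LA 0F + Σsecond 0F + ∑[ b < k₂ ] T (edge₂ b)
    weight-c₂ = begin
      w (old c₂)                                                  ≡⟨ weight-old c₂ ⟩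
      share c₂ 0F + ∑[ e′ < k₁ + k₂ ] share c₂ (Fin.suc e′)
        ≡⟨ cong (share c₂ 0F +_) (∑-+ k₁ k₂ _) ⟩
      LA 0F + Σsecond 0F + (∑[ a < k₁ ] share c₂ (edge₁ a) + ∑[ b < k₂ ] share c₂ (edge₂ b))
        ≡⟨ cong (LA 0F + Σsecond 0F +_)
                (cong₂ _+_ (∑-zero λ a → share-at c₂ _ (ends-edge₁ a)) (sum-cong-≗ share-edge₂)) ⟩
      LA 0F + Σsecond 0F + ∑[ b < k₂ ] T (edge₂ b)                ∎
      where open ≡-Reasoning

    weight-leaf : ∀ e′ → w (old (leaf e′)) ≡ LA (Fin.suc e′) + Σsecond (Fin.suc e′)
    weight-leaf e′ = trans (weight-old (leaf e′)) (trans (∑-single (Fin.suc e′) elsewhere) atOwnEdge)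
      where
      otherLeaf : ∀ {e″} → e″ ≢ e′ → ⌊ leaf e″ Finₚ.≟ leaf e′ ⌋ ≡ false
      otherLeaf e″≢e′ = ⌊≟⌋-≢ (e″≢e′ ∘ Finₚ.↑ʳ-injective 2 _ _)
      elsewhere : ∀ e → e ≢ Fin.suc e′ → share (leaf e′) e ≡ 0
      elsewhere 0F           _  = refl
      elsewhere (Fin.suc e″) e≢ with ends-leafEdge e″
      ... | inj₁ ends≡ = trans (share-at (leaf e′) _ ends≡)
                               (cong (λ b → shareWith false b (Fin.suc e″)) (otherLeaf (e≢ ∘ cong Fin.suc)))
      ... | inj₂ ends≡ = trans (share-at (leaf e′) _ ends≡)
                               (cong (λ b → shareWith false b (Fin.suc e″)) (otherLeaf (e≢ ∘ cong Fin.suc)))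
      atOwnEdge : share (leaf e′) (Fin.suc e′) ≡ LA (Fin.suc e′) + Σsecond (Fin.suc e′)
      atOwnEdge with ends-leafEdge e′
      ... | inj₁ ends≡ = trans (share-at (leaf e′) _ ends≡)
                               (cong (λ b → shareWith false b (Fin.suc e′)) (⌊≟⌋-refl (leaf e′)))
      ... | inj₂ ends≡ = trans (share-at (leaf e′) _ ends≡)
                               (cong (λ b → shareWith false b (Fin.suc e′)) (⌊≟⌋-refl (leaf e′)))

  record Balanced (f : Labeling GK) : Set where
    open DoubleStarWeights f
    field
      K                 : ℕ
      label-gEdge       : ∀ e → LA e ≡ suc (N + N + toℕ e)
      label-pair        : ∀ q → L (firstEdge q) + L (secondEdge q) ≡ suc (N + N)
      leaf-balanced     : ∀ e′ → Σsecond (Fin.suc e′) + toℕ (Fin.suc e′) ≡ K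
      leaf-bounded      : ∀ e′ → Σsecond (Fin.suc e′) ≤ N + N + Σfirst (Fin.suc e′)
      centre-unbalanced : Σfirst 0F < Σsecond 0F

  module FourWeights {f : Labeling GK} (k₁>0 : 0 < k₁) (k₁≤k₂ : k₁ ≤ k₂) (balanced : Balanced f) where

    open DoubleStarWeights f
    open Balanced balanced

    P Q : ℕ
    P = suc (N + N)
    Q = P + K

    weight-copy≡P : ∀ q → w (copy q) ≡ P
    weight-copy≡P q = trans (weight-copy q) (label-pair q)

    weight-leaf≡Q : ∀ e′ → w (old (leaf e′)) ≡ Q
    weight-leaf≡Q e′ = begin
      w (old (leaf e′))                            ≡⟨ weight-leaf e′ ⟩
      LA e + Σsecond e                             ≡⟨ cong (_+ Σsecond e) (label-gEdge e) ⟩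
      suc (N + N + toℕ e) + Σsecond e              ≡⟨ shuffle (N + N) (toℕ e) (Σsecond e) ⟩
      P + (Σsecond e + toℕ e)                      ≡⟨ cong (P +_) (leaf-balanced e′) ⟩
      Q                                            ∎
      where
      open ≡-Reasoning
      e = Fin.suc e′
      shuffle : ∀ a t s → suc (a + t) + s ≡ suc a + (s + t)
      shuffle = solve-∀

    Σfirst+Σsecond : ∀ e → Σfirst e + Σsecond e ≡ r * P
    Σfirst+Σsecond e = begin
      Σfirst e + Σsecond e
        ≡⟨ ∑-distrib-+ (L ∘ firstEdge ∘ combine e) (L ∘ secondEdge ∘ combine e) ⟨
      ∑[ x < r ] (L (firstEdge (combine e x)) + L (secondEdge (combine e x)))
        ≡⟨ sum-cong-≗ (label-pair ∘ combine e) ⟩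
      ∑[ x < r ] P                               ≡⟨ ∑-const r P ⟩
      r * P                                      ∎
      where open ≡-Reasoning

    T-leaf : ∀ e′ → T (Fin.suc e′) + K ≡ suc (N + N + suc (toℕ e′)) + r * P + suc (toℕ e′)
    T-leaf e′ = begin
      LA e + Σfirst e + K                          ≡⟨ cong (LA e + Σfirst e +_) (leaf-balanced e′) ⟨
      LA e + Σfirst e + (Σsecond e + toℕ e)        ≡⟨ regroup (LA e) (Σfirst e) (Σsecond e) (toℕ e) ⟩
      LA e + (Σfirst e + Σsecond e) + toℕ e
        ≡⟨ cong₂ (λ a b → a + b + toℕ e) (label-gEdge e) (Σfirst+Σsecond e) ⟩
      suc (N + N + toℕ e) + r * P + toℕ e          ∎
      where
      open ≡-Reasoning
      e = Fin.suc e′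
      regroup : ∀ a b c d → a + b + (c + d) ≡ a + (b + c) + d
      regroup = solve-∀

    T-mono : ∀ {e′ e″} → toℕ e′ ≤ toℕ e″ → T (Fin.suc e′) ≤ T (Fin.suc e″)
    T-mono {e′} {e″} t≤t′ = +-cancelʳ-≤ K _ _ (subst₂ _≤_ (sym (T-leaf e′)) (sym (T-leaf e″))
      (+-mono-≤ (+-monoˡ-≤ (r * P) (s≤s (+-monoʳ-≤ (N + N) (s≤s t≤t′)))) (s≤s t≤t′)))

    Q<LA₀+T : ∀ e′ → Q < LA 0F + T (Fin.suc e′)
    Q<LA₀+T e′ = begin-strict
      Q                                 ≡⟨ weight-leaf≡Q e′ ⟨
      w (old (leaf e′))                 ≡⟨ weight-leaf e′ ⟩
      LA e + Σsecond e                  ≤⟨ +-monoʳ-≤ (LA e) (leaf-bounded e′) ⟩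
      LA e + (N + N + Σfirst e)         <⟨ +-monoʳ-< (LA e) (+-monoˡ-< (Σfirst e) N+N<LA₀) ⟩
      LA e + (LA 0F + Σfirst e)         ≡⟨ swapFront (LA e) (LA 0F) (Σfirst e) ⟩
      LA 0F + T e                       ∎
      where
      open ≤-Reasoning
      e = Fin.suc e′
      N+N<LA₀ : N + N < LA 0F
      N+N<LA₀ = subst (N + N <_) (sym (label-gEdge 0F)) (s≤s (≤-reflexive (sym (+-identityʳ (N + N)))))
      swapFront : ∀ a b c → a + (b + c) ≡ b + (a + c)
      swapFront = solve-∀

    a₀ : Fin k₁
    a₀ = Fin.fromℕ< k₁>0

    Q<c₁ : Q < w (old c₁)
    Q<c₁ = begin-strict
      Q                                             <⟨ Q<LA₀+T (a₀ ↑ˡ k₂) ⟩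
      LA 0F + T (edge₁ a₀)                          ≤⟨ +-monoʳ-≤ (LA 0F) (term≤∑ (T ∘ edge₁) a₀) ⟩
      LA 0F + ∑[ a < k₁ ] T (edge₁ a)               ≤⟨ +-monoˡ-≤ _ (m≤m+n (LA 0F) (Σfirst 0F)) ⟩
      LA 0F + Σfirst 0F + ∑[ a < k₁ ] T (edge₁ a)   ≡⟨ weight-c₁ ⟨
      w (old c₁)                                    ∎
      where open ≤-Reasoning

    c₁<c₂ : w (old c₁) < w (old c₂)
    c₁<c₂ = subst₂ _<_ (sym weight-c₁) (sym weight-c₂)
      (+-mono-<-≤ (+-monoʳ-< (LA 0F) centre-unbalanced) (≤-trans
        (∑-mono-≤ λ a → T-mono (<⇒≤ (↑ˡ<↑ʳ a (Fin.inject≤ a k₁≤k₂))))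
        (∑-inject≤ k₁≤k₂ (T ∘ edge₂))))

    Q<c₂ : Q < w (old c₂)
    Q<c₂ = <-trans Q<c₁ c₁<c₂

    P<Q : P < Q
    P<Q = m<m+n P (subst (0 <_) (leaf-balanced (a₀ ↑ˡ k₂)) (<-≤-trans z<s (m≤n+m _ _)))

    P<old : ∀ v → P < w (old v)
    P<old 0F                     = <-trans P<Q Q<c₁
    P<old 1F                     = <-trans P<Q Q<c₂
    P<old (Fin.suc (Fin.suc e′)) = subst (P <_) (sym (weight-leaf≡Q e′)) P<Q

    differOnG : ∀ e → w (old (first e)) ≢ w (old (second e))
    differOnG 0F           = <⇒≢ c₁<c₂
    differOnG (Fin.suc e′) with ends-leafEdge e′
    ... | inj₁ ends≡ = subst (λ (a , b) → w (old a) ≢ w (old b)) (sym ends≡)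
                         (≢-sym (<⇒≢ (subst (_< w (old c₁)) (sym (weight-leaf≡Q e′)) Q<c₁)))
    ... | inj₂ ends≡ = subst (λ (a , b) → w (old a) ≢ w (old b)) (sym ends≡)
                         (≢-sym (<⇒≢ (subst (_< w (old c₂)) (sym (weight-leaf≡Q e′)) Q<c₂)))

    antimagic : IsLocalAntimagic GK f
    antimagic = antimagic-criterion P weight-copy≡P P<old differOnG

    colours : numColors GK f ≤ 4
    colours = numColors≤length GK f (w (old c₁) ∷ w (old c₂) ∷ P ∷ Q ∷ [])
      (vertexCases _ onOld λ q → there (there (here (weight-copy≡P q))))
      where
      onOld : ∀ v → w (old v) ∈ (w (old c₁) ∷ w (old c₂) ∷ P ∷ Q ∷ [])
      onOld 0F                     = here refl
      onOld 1F                     = there (here refl)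
      onOld (Fin.suc (Fin.suc e′)) = there (there (there (here (weight-leaf≡Q e′))))

  balanced⇒χla≤4 : 0 < k₁ → k₁ ≤ k₂ → ∀ f → Balanced f → χla≤ GK 4
  balanced⇒χla≤4 k₁>0 k₁≤k₂ f balanced = f , antimagic , colours
    where open FourWeights k₁>0 k₁≤k₂ balanced

-- Row arrangements

interleave : ∀ n → Fin ⌈ n /2⌉ ⊎ Fin ⌊ n /2⌋ → Fin n
interleave (suc zero)    (inj₁ 0F)          = 0F
interleave (suc (suc n)) (inj₁ 0F)          = 0F
interleave (suc (suc n)) (inj₂ 0F)          = 1F
interleave (suc (suc n)) (inj₁ (Fin.suc a)) = Fin.suc (Fin.suc (interleave n (inj₁ a)))
interleave (suc (suc n)) (inj₂ (Fin.suc b)) = Fin.suc (Fin.suc (interleave n (inj₂ b)))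

deinterleave : ∀ n → Fin n → Fin ⌈ n /2⌉ ⊎ Fin ⌊ n /2⌋
deinterleave (suc zero)    0F                     = inj₁ 0F
deinterleave (suc (suc n)) 0F                     = inj₁ 0F
deinterleave (suc (suc n)) 1F                     = inj₂ 0F
deinterleave (suc (suc n)) (Fin.suc (Fin.suc u)) = Sum.map Fin.suc Fin.suc (deinterleave n u)

interleave-deinterleave : ∀ n u → interleave n (deinterleave n u) ≡ u
interleave-deinterleave (suc zero)    0F                    = refl
interleave-deinterleave (suc (suc n)) 0F                    = refl
interleave-deinterleave (suc (suc n)) 1F                    = refl
interleave-deinterleave (suc (suc n)) (Fin.suc (Fin.suc u))
  with deinterleave n u | interleave-deinterleave n u
... | inj₁ _ | eq = cong (λ v → Fin.suc (Fin.suc v)) eq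
... | inj₂ _ | eq = cong (λ v → Fin.suc (Fin.suc v)) eq

deinterleave-interleave : ∀ n s → deinterleave n (interleave n s) ≡ s
deinterleave-interleave (suc zero)    (inj₁ 0F)          = refl
deinterleave-interleave (suc (suc n)) (inj₁ 0F)          = refl
deinterleave-interleave (suc (suc n)) (inj₂ 0F)          = refl
deinterleave-interleave (suc (suc n)) (inj₁ (Fin.suc a)) =
  cong (Sum.map Fin.suc Fin.suc) (deinterleave-interleave n (inj₁ a))
deinterleave-interleave (suc (suc n)) (inj₂ (Fin.suc b)) =
  cong (Sum.map Fin.suc Fin.suc) (deinterleave-interleave n (inj₂ b))

interleave-↔ : ∀ n → (Fin ⌈ n /2⌉ ⊎ Fin ⌊ n /2⌋) ↔ Fin n
interleave-↔ n = mk↔ₛ′ (interleave n) (deinterleave n) (interleave-deinterleave n) (deinterleave-interleave n)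

toℕ-interleave-inj₁ : ∀ n a → toℕ (interleave n (inj₁ a)) ≡ toℕ a + toℕ a
toℕ-interleave-inj₁ (suc zero)    0F          = refl
toℕ-interleave-inj₁ (suc (suc n)) 0F          = refl
toℕ-interleave-inj₁ (suc (suc n)) (Fin.suc a) =
  trans (cong (λ k → suc (suc k)) (toℕ-interleave-inj₁ n a)) (cong suc (sym (+-suc (toℕ a) (toℕ a))))

toℕ-interleave-inj₂ : ∀ n b → toℕ (interleave n (inj₂ b)) ≡ suc (toℕ b + toℕ b)
toℕ-interleave-inj₂ (suc (suc n)) 0F          = refl
toℕ-interleave-inj₂ (suc (suc n)) (Fin.suc b) =
  trans (cong (λ k → suc (suc k)) (toℕ-interleave-inj₂ n b))
        (cong (λ k → suc (suc k)) (sym (+-suc (toℕ b) (toℕ b))))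

n≡⌈n/2⌉+⌊n/2⌋ : ∀ n → n ≡ ⌈ n /2⌉ + ⌊ n /2⌋
n≡⌈n/2⌉+⌊n/2⌋ n = trans (sym (⌊n/2⌋+⌈n/2⌉≡n n)) (+-comm ⌊ n /2⌋ ⌈ n /2⌉)

fold : ∀ n → Permutation′ n
fold n = ↔-trans (cast-id (n≡⌈n/2⌉+⌊n/2⌋ n))
                 (↔-trans +↔⊎ (↔-trans (↔-refl ⊎-↔ reverse) (interleave-↔ n)))

private
  halfOf : ∀ n → Fin n → Fin ⌈ n /2⌉ ⊎ Fin ⌊ n /2⌋
  halfOf n e = splitAt ⌈ n /2⌉ (cast (n≡⌈n/2⌉+⌊n/2⌋ n) e)

  halfOf-lower : ∀ {n e a} → halfOf n e ≡ inj₁ a → toℕ a ≡ toℕ e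
  halfOf-lower {n} {e} {a} eq =
    trans (sym (Finₚ.toℕ-↑ˡ a ⌊ n /2⌋))
          (trans (cong toℕ (Finₚ.splitAt⁻¹-↑ˡ eq)) (Finₚ.toℕ-cast _ e))

  halfOf-upper : ∀ {n e b} → halfOf n e ≡ inj₂ b → ⌈ n /2⌉ + toℕ b ≡ toℕ e
  halfOf-upper {n} {e} {b} eq =
    trans (sym (Finₚ.toℕ-↑ʳ ⌈ n /2⌉ b))
          (trans (cong toℕ (Finₚ.splitAt⁻¹-↑ʳ eq)) (Finₚ.toℕ-cast _ e))

toℕ-fold-lower : ∀ n (e : Fin n) → toℕ e < ⌈ n /2⌉ → toℕ (fold n ⟨$⟩ʳ e) ≡ toℕ e + toℕ e
toℕ-fold-lower n e e<half with halfOf n e in eq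
... | inj₁ a = trans (toℕ-interleave-inj₁ n a) (cong (λ t → t + t) (halfOf-lower eq))
... | inj₂ b = contradiction (subst (⌈ n /2⌉ ≤_) (halfOf-upper eq) (m≤m+n _ _)) (<⇒≱ e<half)

toℕ-fold-upper : ∀ n (e : Fin n) → ⌈ n /2⌉ ≤ toℕ e →
                 suc (toℕ (fold n ⟨$⟩ʳ e) + (toℕ e + toℕ e)) ≡ n + n
toℕ-fold-upper n e half≤e with halfOf n e in eq
... | inj₁ a = contradiction (subst (_< ⌈ n /2⌉) (halfOf-lower eq) (Finₚ.toℕ<n a)) (≤⇒≯ half≤e)
... | inj₂ b = begin
  suc (toℕ (interleave n (inj₂ (opposite b))) + (toℕ e + toℕ e))
    ≡⟨ cong₂ (λ i t → suc (i + (t + t))) (toℕ-interleave-inj₂ n (opposite b)) (sym (halfOf-upper eq)) ⟩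
  suc (suc (o + o) + ((⌈ n /2⌉ + toℕ b) + (⌈ n /2⌉ + toℕ b)))  ≡⟨ regroup o (toℕ b) ⌈ n /2⌉ ⟩
  (o + suc (toℕ b) + ⌈ n /2⌉) + (o + suc (toℕ b) + ⌈ n /2⌉)
    ≡⟨ cong (λ k → (k + ⌈ n /2⌉) + (k + ⌈ n /2⌉)) o+b ⟩
  (⌊ n /2⌋ + ⌈ n /2⌉) + (⌊ n /2⌋ + ⌈ n /2⌉)  ≡⟨ cong (λ k → k + k) (⌊n/2⌋+⌈n/2⌉≡n n) ⟩
  n + n                                      ∎
  where
  open ≡-Reasoning
  o = toℕ (opposite b)
  o+b : o + suc (toℕ b) ≡ ⌊ n /2⌋
  o+b = trans (cong (_+ suc (toℕ b)) (Finₚ.opposite-prop b)) (m∸n+n≡m (Finₚ.toℕ<n b))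
  regroup : ∀ o b c → suc (suc (o + o) + ((c + b) + (c + b))) ≡ (o + suc b + c) + (o + suc b + c)
  regroup = solve-∀

toℕ+toℕ-opposite : ∀ {M} (e : Fin (suc M)) → toℕ e + toℕ (opposite e) ≡ M
toℕ+toℕ-opposite e = trans (cong (toℕ e +_) (Finₚ.opposite-prop e)) (m+[n∸m]≡n (≤-pred (Finₚ.toℕ<n e)))

balancedRows : ∀ {m} h → Fin (h * 2) → Permutation′ m
balancedRows (suc h) 0F                    = ↔-refl
balancedRows (suc h) 1F                    = reverse
balancedRows (suc h) (Fin.suc (Fin.suc x)) = balancedRows h x

∑-balancedRows : ∀ {M} h (e : Fin (suc M)) → ∑[ x < h * 2 ] toℕ (balancedRows h x ⟨$⟩ʳ e) ≡ h * M
∑-balancedRows zero    e = refl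
∑-balancedRows (suc h) e =
  trans (sym (+-assoc (toℕ e) _ _)) (cong₂ _+_ (toℕ+toℕ-opposite e) (∑-balancedRows h e))

module Rows (k₁ k₂ r′ : ℕ) where

  open DoubleStar k₁ k₂ (suc r′) public

  module Arrangement (τ : Fin (suc r′) → Permutation′ m) (flipped : Fin m → Fin (suc r′) → Bool) where

    open RowLabeling τ flipped public
    open DoubleStarWeights labeling public using (Σfirst; Σsecond)

    Σsecond-unflipped : ∀ {k} (row : Fin k → Fin (suc r′)) e → (∀ x → flipped e (row x) ≡ false) →
                        ∑[ x < k ] L (secondEdge (combine e (row x))) ≡ ∑[ x < k ] suc (position e (row x))
    Σsecond-unflipped row e unflipped = sum-cong-≗ λ x → label-second-unflipped e (row x) (unflipped x)

    rows⇒balanced : (∀ x → flipped 0F x ≡ true) → (∀ e′ x → flipped (Fin.suc e′) (Fin.suc x) ≡ false) →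
                    ∀ K → (∀ e′ → Σsecond (Fin.suc e′) + toℕ (Fin.suc e′) ≡ K) → Balanced labeling
    rows⇒balanced centre-flipped leaves-unflipped K leaf-balanced = record
      { K                 = K
      ; label-gEdge       = label-gEdge
      ; label-pair        = label-pair
      ; leaf-balanced     = leaf-balanced
      ; leaf-bounded      = leaf-bounded
      ; centre-unbalanced = ∑-mono-< λ x → first<second-flipped 0F x (centre-flipped x)
      }
      where
      leaf-bounded : ∀ e′ → Σsecond (Fin.suc e′) ≤ N + N + Σfirst (Fin.suc e′)
      leaf-bounded e′ = ≤-trans
        (+-mono-≤ (≤-trans (label-second≤N+N (combine e 0F)) (m≤m+n (N + N) _))
                  (∑-mono-≤ λ x → second≤first-unflipped e (Fin.suc x) (leaves-unflipped e′ x)))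
        (≤-reflexive (+-assoc (N + N) _ _))
        where e = Fin.suc e′

module OddRows (k₁ k₂ h : ℕ) where

  open Rows k₁ k₂ (h * 2) public

  τ : Fin (suc (h * 2)) → Permutation′ m
  τ 0F          = reverse
  τ (Fin.suc x) = balancedRows h x

  flipped : Fin m → Fin (suc (h * 2)) → Bool
  flipped 0F          _ = true
  flipped (Fin.suc _) _ = false

  open Arrangement τ flipped public

  ∑-τ : ∀ e → ∑[ x < suc (h * 2) ] toℕ (τ x ⟨$⟩ʳ e) + toℕ e ≡ suc h * (k₁ + k₂)
  ∑-τ e = begin
    toℕ (opposite e) + ∑[ x < h * 2 ] toℕ (balancedRows h x ⟨$⟩ʳ e) + toℕ e
      ≡⟨ cong (λ s → toℕ (opposite e) + s + toℕ e) (∑-balancedRows h e) ⟩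
    toℕ (opposite e) + h * (k₁ + k₂) + toℕ e     ≡⟨ swap (toℕ (opposite e)) (h * (k₁ + k₂)) (toℕ e) ⟩
    toℕ e + toℕ (opposite e) + h * (k₁ + k₂)     ≡⟨ cong (_+ h * (k₁ + k₂)) (toℕ+toℕ-opposite e) ⟩
    suc h * (k₁ + k₂)                            ∎
    where
    open ≡-Reasoning
    swap : ∀ o s t → o + s + t ≡ t + o + s
    swap = solve-∀

  balanced : Balanced labeling
  balanced = rows⇒balanced (λ _ → refl) (λ _ _ → refl) K leaf-balanced
    where
    C = ∑[ x < suc (h * 2) ] suc (m * toℕ (opposite x))
    K = C + suc h * (k₁ + k₂)
    leaf-balanced : ∀ e′ → Σsecond (Fin.suc e′) + toℕ (Fin.suc e′) ≡ K
    leaf-balanced e′ = begin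
      Σsecond e + toℕ e
        ≡⟨ cong (_+ toℕ e) (Σsecond-unflipped id e (λ _ → refl)) ⟩
      ∑[ x < suc (h * 2) ] (suc (m * toℕ (opposite x)) + toℕ (τ x ⟨$⟩ʳ e)) + toℕ e
        ≡⟨ cong (_+ toℕ e) (∑-distrib-+ (λ x → suc (m * toℕ (opposite x))) (λ x → toℕ (τ x ⟨$⟩ʳ e))) ⟩
      C + ∑[ x < suc (h * 2) ] toℕ (τ x ⟨$⟩ʳ e) + toℕ e  ≡⟨ +-assoc C _ (toℕ e) ⟩
      C + (∑[ x < suc (h * 2) ] toℕ (τ x ⟨$⟩ʳ e) + toℕ e) ≡⟨ cong (C +_) (∑-τ e) ⟩
      K                                                  ∎
      where
      open ≡-Reasoning
      e = Fin.suc e′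

module EvenRows (k₁ k₂ h : ℕ) where

  open Rows k₁ k₂ (suc (h * 2)) public

  -- On the leaf side, row 0 carries N + m − 2e (leafSide-row₀) and the identity row 1 gains e back; the
  -- remaining rows cancel in pairs.
  τ : Fin (suc (suc (h * 2))) → Permutation′ m
  τ 0F                    = fold m
  τ 1F                    = ↔-refl
  τ (Fin.suc (Fin.suc x)) = balancedRows h x

  flipped : Fin m → Fin (suc (suc (h * 2))) → Bool
  flipped e           0F          = ⌊ toℕ e <? ⌈ m /2⌉ ⌋
  flipped 0F          (Fin.suc _) = true
  flipped (Fin.suc _) (Fin.suc _) = false

  open Arrangement τ flipped public

  R : ℕ
  R = suc (h * 2)

  position-fold : ∀ e → position e 0F ≡ m * R + toℕ (fold m ⟨$⟩ʳ e)
  position-fold e = cong (λ o → m * o + toℕ (fold m ⟨$⟩ʳ e)) (Finₚ.toℕ-fromℕ R)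

  leafSide-row₀ : ∀ e → L (secondEdge (combine e 0F)) + (toℕ e + toℕ e) ≡ N + m
  leafSide-row₀ e with toℕ e <? ⌈ m /2⌉ in eq
  ... | yes lower = +-cancelʳ-≡ (suc (m * R)) _ _ (begin
    L₂ + (toℕ e + toℕ e) + suc (m * R)   ≡⟨ shuffle L₂ (toℕ e + toℕ e) (m * R) ⟩
    L₂ + suc (m * R + (toℕ e + toℕ e))   ≡⟨ cong (λ p → L₂ + suc p) (sym (trans (position-fold e)
                                              (cong (m * R +_) (toℕ-fold-lower m e lower)))) ⟩
    L₂ + suc (position e 0F)             ≡⟨ cong (L₂ +_) (label-first-flipped e 0F (cong ⌊_⌋ eq)) ⟨
    L₂ + L₁                              ≡⟨ +-comm L₂ L₁ ⟩
    L₁ + L₂                              ≡⟨ label-pair (combine e 0F) ⟩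
    suc (N + N)                          ≡⟨ cong (λ n′ → suc (N + n′)) (*-suc m R) ⟩
    suc (N + (m + m * R))                ≡⟨ shuffle′ N m (m * R) ⟩
    N + m + suc (m * R)                  ∎)
    where
    open ≡-Reasoning
    L₁ = L (firstEdge (combine e 0F))
    L₂ = L (secondEdge (combine e 0F))
    shuffle : ∀ s d p → s + d + suc p ≡ s + suc (p + d)
    shuffle = solve-∀
    shuffle′ : ∀ n a b → suc (n + (a + b)) ≡ n + a + suc b
    shuffle′ = solve-∀
  ... | no upper = begin
    L (secondEdge (combine e 0F)) + (toℕ e + toℕ e)
      ≡⟨ cong (_+ (toℕ e + toℕ e)) (label-second-unflipped e 0F (cong ⌊_⌋ eq)) ⟩
    suc (position e 0F) + (toℕ e + toℕ e)  ≡⟨ cong (λ p → suc p + (toℕ e + toℕ e)) (position-fold e) ⟩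
    suc (m * R + f) + (toℕ e + toℕ e)      ≡⟨ shuffle (m * R) f (toℕ e + toℕ e) ⟩
    m * R + suc (f + (toℕ e + toℕ e))      ≡⟨ cong (m * R +_) (toℕ-fold-upper m e (≮⇒≥ upper)) ⟩
    m * R + (m + m)                        ≡⟨ shuffle′ (m * R) m ⟩
    m + m * R + m                          ≡⟨ cong (_+ m) (*-suc m R) ⟨
    N + m                                  ∎
    where
    open ≡-Reasoning
    f = toℕ (fold m ⟨$⟩ʳ e)
    shuffle : ∀ a b c → suc (a + b) + c ≡ a + suc (b + c)
    shuffle = solve-∀
    shuffle′ : ∀ a b → a + (b + b) ≡ b + a + b
    shuffle′ = solve-∀

  balanced : Balanced labeling
  balanced = rows⇒balanced (λ { 0F → refl ; (Fin.suc _) → refl }) (λ _ _ → refl) K leaf-balanced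
    where
    C = ∑[ x < R ] suc (m * toℕ (opposite (Fin.suc x)))
    K = N + m + (C + h * (k₁ + k₂))
    leaf-balanced : ∀ e′ → Σsecond (Fin.suc e′) + toℕ (Fin.suc e′) ≡ K
    leaf-balanced e′ = begin
      L₀ + ∑[ x < R ] L (secondEdge (combine e (Fin.suc x))) + toℕ e
        ≡⟨ cong (λ s → L₀ + s + toℕ e) (Σsecond-unflipped Fin.suc e (λ _ → refl)) ⟩
      L₀ + ∑[ x < R ] (suc (m * toℕ (opposite (Fin.suc x))) + toℕ (τ (Fin.suc x) ⟨$⟩ʳ e)) + toℕ e
        ≡⟨ cong (λ s → L₀ + s + toℕ e) (∑-distrib-+ (λ x → suc (m * toℕ (opposite (Fin.suc x))))
                                                     (λ x → toℕ (τ (Fin.suc x) ⟨$⟩ʳ e))) ⟩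
      L₀ + (C + (toℕ e + ∑[ x < h * 2 ] toℕ (balancedRows h x ⟨$⟩ʳ e))) + toℕ e
        ≡⟨ cong (λ s → L₀ + (C + (toℕ e + s)) + toℕ e) (∑-balancedRows h e) ⟩
      L₀ + (C + (toℕ e + h * (k₁ + k₂))) + toℕ e  ≡⟨ regroup L₀ C (toℕ e) (h * (k₁ + k₂)) ⟩
      L₀ + (toℕ e + toℕ e) + (C + h * (k₁ + k₂))  ≡⟨ cong (_+ (C + h * (k₁ + k₂))) (leafSide-row₀ e) ⟩
      K                                           ∎
      where
      open ≡-Reasoning
      e = Fin.suc e′
      L₀ = L (secondEdge (combine e 0F))
      regroup : ∀ a c t s → a + (c + (t + s)) + t ≡ a + (t + t) + (c + s)
      regroup = solve-∀

data Parity : ℕ → Set where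
  odd  : ∀ h → Parity (suc (h * 2))
  even : ∀ h → Parity (suc (suc (h * 2)))

parity : ∀ r → Parity (suc r)
parity zero          = odd 0
parity (suc zero)    = even 0
parity (suc (suc r)) with parity r
... | odd h  = odd (suc h)
... | even h = even (suc h)

doubleStarCorona-χla≤4 : ∀ k₁ k₂ r → 0 < k₁ → k₁ ≤ k₂ →
                         χla≤ (doubleStar k₁ k₂ ⋄ emptyGraph (suc r)) 4
doubleStarCorona-χla≤4 k₁ k₂ r k₁>0 k₁≤k₂ with parity r
... | odd h  = OddRows.balanced⇒χla≤4 k₁ k₂ h k₁>0 k₁≤k₂ _ (OddRows.balanced k₁ k₂ h)
... | even h = EvenRows.balanced⇒χla≤4 k₁ k₂ h k₁>0 k₁≤k₂ _ (EvenRows.balanced k₁ k₂ h)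

mainTheorem8 : (k₁ k₂ r : ℕ) → 0 < k₁ → k₁ ≤ k₂ → 0 < r →
    χla≥ (doubleStar k₁ k₂ ⋄ emptyGraph r) 3 × χla≤ (doubleStar k₁ k₂ ⋄ emptyGraph r) 4
mainTheorem8 k₁ k₂ (suc r) k₁>0 k₁≤k₂ _ =
  DoubleStar.χla≥3 k₁ k₂ (suc r) 0F 0F , doubleStarCorona-χla≤4 k₁ k₂ r k₁>0 k₁≤k₂
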